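{- Let $(X,\le)$ be a poset and $E$ an equivalence relation on $X$ with ${\le}\subseteq E$. Let $\alpha\colon X\to X$ be an order automorphism of $(X,\le)$ with $\alpha\subseteq E$ and $\beta\colon X\to X$ a dual order automorphism of $(X,\le)$ with $\beta\subseteq E$. Then: (i) if $R,S\in\mathsf{Up}(\mathbf E)$ then $R\circ S\in\mathsf{Up}(\mathbf E)$; (ii) if $R,S\in\mathsf{Down}(\mathbf E)$ then $R\circ S\in\mathsf{Down}(\mathbf E)$; (iii) $R\in\mathsf{Up}(\mathbf E)$ iff $R^{c}\in\mathsf{Down}(\mathbf E)$; (iv) $R\in\mathsf{Up}(\mathbf E)$ iff $R^{\smile}\in\mathsf{Down}(\mathbf E)$; (v) if $R\in\mathsf{Up}(\mathbf E)$ then $\alpha\circ R\in\mathsf{Up}(\mathbf E)$ and $R\circ\alpha\in\mathsf{Up}(\mathbf E)$; (vi) if $R\in\mathsf{Down}(\mathbf E)$ then $\beta\circ R\circ\beta\in\mathsf{Up}(\mathbf E)$.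
   Context: Relations: $R\circ S=\{(x,y)\mid\exists z\,((x,z)\in R,(z,y)\in S)\}$, $R^{\smile}=\{(x,y)\mid(y,x)\in R\}$; functions are identified with their graphs $\{(x,\gamma(x))\}$. Order automorphism: bijection with $x\le y\iff\alpha(x)\le\alpha(y)$; dual order automorphism: bijection with $x\le y\iff\beta(y)\le\beta(x)$. $E$ is partially ordered by $(u,v)\preceq(x,y)$ iff $x\le u$ and $v\le y$; $\mathbf E=(E,\preceq)$; $\mathsf{Up}(\mathbf E)$ and $\mathsf{Down}(\mathbf E)$ are the sets of up-sets and down-sets of $\mathbf E$ (subsets of $E$); $R^{c}=E\setminus R$ for $R\subseteq E$. -}

module Defs where

open import Level using (0ℓ)
open import Data.Product using (Σ; ∃; _×_; _,_)
open import Relation.Nullary using (¬_)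
open import Relation.Binary.PropositionalEquality using (_≡_)
open import Relation.Binary.Structures using (IsPartialOrder; IsEquivalence)
open import Function.Definitions using (Bijective)
open import Function.Bundles using (_⇔_)

Rel : Set → Set₁
Rel X = X → X → Set

_⊆ᴿ_ : {X : Set} → Rel X → Rel X → Set
R ⊆ᴿ S = ∀ {x y} → R x y → S x y

_∘ᴿ_ : {X : Set} → Rel X → Rel X → Rel X
(R ∘ᴿ S) x y = ∃ λ z → R x z × S z y

_⌣ : {X : Set} → Rel X → Rel X
(R ⌣) x y = R y x

graph : {X : Set} → (X → X) → Rel X
graph γ x y = γ x ≡ y

compl : {X : Set} (E : Rel X) → Rel X → Rel X
compl E R x y = E x y × ¬ R x y

IsOrderAutomorphism : {X : Set} → Rel X → (X → X) → Set
IsOrderAutomorphism _≤_ α =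
  Bijective _≡_ _≡_ α × (∀ x y → (x ≤ y) ⇔ (α x ≤ α y))

IsDualOrderAutomorphism : {X : Set} → Rel X → (X → X) → Set
IsDualOrderAutomorphism _≤_ β =
  Bijective _≡_ _≡_ β × (∀ x y → (x ≤ y) ⇔ (β y ≤ β x))

_⊢_⪯_ : {X : Set} → Rel X → X × X → X × X → Set
_⊢_⪯_ _≤_ (u , v) (x , y) = (x ≤ u) × (v ≤ y)

Up : {X : Set} (_≤_ : Rel X) (E : Rel X) → Rel X → Set
Up _≤_ E R =
  (R ⊆ᴿ E) ×
  (∀ {u v x y} → R u v → E x y → _≤_ ⊢ (u , v) ⪯ (x , y) → R x y)

Down : {X : Set} (_≤_ : Rel X) (E : Rel X) → Rel X → Set
Down _≤_ E R =
  (R ⊆ᴿ E) ×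
  (∀ {u v x y} → R x y → E u v → _≤_ ⊢ (u , v) ⪯ (x , y) → R u v)

-- Each item is a direct check against the definition of ⪯: a witness for a
-- composite is transported along the given inequalities, with E-membership
-- of the new pair coming from E being an equivalence containing ≤ and the
-- graphs of α and β. For (v) and (vi) the composite with α or β on the right
-- needs the new endpoint to be an image point, hence surjectivity, and the
-- inequality there is pulled back because α (resp. β) reflects the order.
-- Only the reverse direction of (iii) is classical.
module Submission where

open import Defs
open import Data.Product using (_×_; _,_; proj₂)
open import Relation.Binary.PropositionalEquality as ≡ using (_≡_; refl; subst)
open import Relation.Binary.Core using (_Preserves_⟶_)
open import Relation.Binary.Definitions using (Reflexive; Symmetric; Transitive)
open import Relation.Binary.Structures using (IsPartialOrder; IsEquivalence)
open import Relation.Nullary.Negation.Core using (Stable)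
open import Relation.Nullary.Decidable.Core using (decidable-stable)
open import Function.Base using (flip)
open import Function.Bundles using (_⇔_; mk⇔; Equivalence)
open import Function.Definitions using (Surjective; StrictlySurjective)
open import Function.Consequences using (surjective⇒strictlySurjective)
open import Axiom.ExcludedMiddle using (ExcludedMiddle)
open import Level using (0ℓ)

module UpDownSets {X : Set} (_≤_ E : Rel X) where

  ∘ᴿ-⊆ : Transitive E → {R S : Rel X} → R ⊆ᴿ E → S ⊆ᴿ E → (R ∘ᴿ S) ⊆ᴿ E
  ∘ᴿ-⊆ trans R⊆E S⊆E (_ , r , s) = trans (R⊆E r) (S⊆E s)

  module _ (≤-refl : Reflexive _≤_) (≤⊆E : _≤_ ⊆ᴿ E) (isEq : IsEquivalence E) where
    open IsEquivalence isEq using (sym; trans)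

    Up-∘ᴿ : {R S : Rel X} → Up _≤_ E R → Up _≤_ E S → Up _≤_ E (R ∘ᴿ S)
    Up-∘ᴿ (R⊆E , R-up) (S⊆E , S-up) =
      ∘ᴿ-⊆ trans R⊆E S⊆E ,
      λ { (z , r , s) Exy (x≤u , v≤y) →
            z , R-up r (trans (≤⊆E x≤u) (R⊆E r)) (x≤u , ≤-refl)
              , S-up s (trans (sym (R⊆E r)) (trans (sym (≤⊆E x≤u)) Exy)) (≤-refl , v≤y) }

    Down-∘ᴿ : {R S : Rel X} → Down _≤_ E R → Down _≤_ E S → Down _≤_ E (R ∘ᴿ S)
    Down-∘ᴿ (R⊆E , R-down) (S⊆E , S-down) =
      ∘ᴿ-⊆ trans R⊆E S⊆E ,
      λ { (z , r , s) Euv (x≤u , v≤y) →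
            z , R-down r (trans (sym (≤⊆E x≤u)) (R⊆E r)) (x≤u , ≤-refl)
              , S-down s (trans (sym (R⊆E r)) (trans (≤⊆E x≤u) Euv)) (≤-refl , v≤y) }

  Up⇒Down-compl : {R : Rel X} → Up _≤_ E R → Down _≤_ E (compl E R)
  Up⇒Down-compl (_ , R-up) =
    (λ (Exy , _) → Exy) ,
    λ (Exy , ¬Rxy) Euv uv⪯xy → Euv , λ Ruv → ¬Rxy (R-up Ruv Exy uv⪯xy)

  Down-compl⇒Up : {R : Rel X} → (∀ {x y} → Stable (R x y)) → R ⊆ᴿ E
    → Down _≤_ E (compl E R) → Up _≤_ E R
  Down-compl⇒Up stable R⊆E (_ , C-down) =
    R⊆E ,
    λ Ruv Exy uv⪯xy → stable λ ¬Rxy → proj₂ (C-down (Exy , ¬Rxy) (R⊆E Ruv) uv⪯xy) Ruv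

  module _ (sym : Symmetric E) where

    Up⇒Down-⌣ : {R : Rel X} → Up _≤_ E R → Down _≤_ E (R ⌣)
    Up⇒Down-⌣ (R⊆E , R-up) =
      (λ r → sym (R⊆E r)) , λ r Euv (x≤u , v≤y) → R-up r (sym Euv) (v≤y , x≤u)

    Down⌣⇒Up : {R : Rel X} → Down _≤_ E (R ⌣) → Up _≤_ E R
    Down⌣⇒Up (R⌣⊆E , R⌣-down) =
      (λ r → sym (R⌣⊆E r)) , λ r Exy (x≤u , v≤y) → R⌣-down r (sym Exy) (v≤y , x≤u)

  module _ (isEq : IsEquivalence E) where
    open IsEquivalence isEq using (sym; trans)

    Up-graph∘ᴿ : {α : X → X} → α Preserves _≤_ ⟶ _≤_ → graph α ⊆ᴿ E
      → {R : Rel X} → Up _≤_ E R → Up _≤_ E (graph α ∘ᴿ R)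
    Up-graph∘ᴿ {α} mono α⊆E (R⊆E , R-up) =
      ∘ᴿ-⊆ trans α⊆E R⊆E ,
      λ { {x = x} (_ , refl , r) Exy (x≤u , v≤y) →
            α x , refl , R-up r (trans (sym (α⊆E refl)) Exy) (mono x≤u , v≤y) }

    Up-∘ᴿgraph : {α : X → X} → StrictlySurjective _≡_ α
      → (∀ {x y} → α x ≤ α y → x ≤ y) → graph α ⊆ᴿ E
      → {R : Rel X} → Up _≤_ E R → Up _≤_ E (R ∘ᴿ graph α)
    Up-∘ᴿgraph {α} surj reflects α⊆E (R⊆E , R-up) =
      ∘ᴿ-⊆ trans R⊆E α⊆E ,
      λ { {y = y} (z , r , refl) Exy (x≤u , αz≤y) →
            let (z′ , αz′≡y) = surj y in
            z′ , R-up r (trans Exy (sym (α⊆E αz′≡y)))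
                        (x≤u , reflects (subst (α z ≤_) (≡.sym αz′≡y) αz≤y))
               , αz′≡y }

    Up-graph∘ᴿ∘ᴿgraph : {β : X → X} → β Preserves _≤_ ⟶ flip _≤_
      → StrictlySurjective _≡_ β → (∀ {x y} → β y ≤ β x → x ≤ y) → graph β ⊆ᴿ E
      → {R : Rel X} → Down _≤_ E R → Up _≤_ E ((graph β ∘ᴿ R) ∘ᴿ graph β)
    Up-graph∘ᴿ∘ᴿgraph {β} anti surj reflects β⊆E (R⊆E , R-down) =
      ∘ᴿ-⊆ trans (∘ᴿ-⊆ trans β⊆E R⊆E) β⊆E ,
      λ { {x = x} {y = y} (b , (_ , refl , r) , refl) Exy (x≤u , βb≤y) →
            let (b′ , βb′≡y) = surj y in
            b′ , (β x , refl , R-down r (trans (sym (β⊆E refl)) (trans Exy (sym (β⊆E βb′≡y))))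
                                        (anti x≤u , reflects (subst (β b ≤_) (≡.sym βb′≡y) βb≤y)))
               , βb′≡y }

lemma3p5 : (X : Set) (_≤_ : Rel X) (E : Rel X)
    → IsPartialOrder _≡_ _≤_
    → IsEquivalence E
    → _≤_ ⊆ᴿ E
    → (α : X → X) → IsOrderAutomorphism _≤_ α → graph α ⊆ᴿ E
    → (β : X → X) → IsDualOrderAutomorphism _≤_ β → graph β ⊆ᴿ E
    → ((R S : Rel X) → Up _≤_ E R → Up _≤_ E S → Up _≤_ E (R ∘ᴿ S))
      × ((R S : Rel X) → Down _≤_ E R → Down _≤_ E S → Down _≤_ E (R ∘ᴿ S))
      × (ExcludedMiddle 0ℓ → (R : Rel X) → R ⊆ᴿ E
           → Up _≤_ E R ⇔ Down _≤_ E (compl E R))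
      × ((R : Rel X) → Up _≤_ E R ⇔ Down _≤_ E (R ⌣))
      × ((R : Rel X) → Up _≤_ E R
           → Up _≤_ E (graph α ∘ᴿ R) × Up _≤_ E (R ∘ᴿ graph α))
      × ((R : Rel X) → Down _≤_ E R
           → Up _≤_ E ((graph β ∘ᴿ R) ∘ᴿ graph β))
lemma3p5 X _≤_ E isPO isEq ≤⊆E α ((_ , α-surj) , α-iso) α⊆E β ((_ , β-surj) , β-iso) β⊆E =
  (λ _ _ → Up-∘ᴿ (IsPartialOrder.refl isPO) ≤⊆E isEq) ,
  (λ _ _ → Down-∘ᴿ (IsPartialOrder.refl isPO) ≤⊆E isEq) ,
  (λ em _ R⊆E → mk⇔ Up⇒Down-compl (Down-compl⇒Up (decidable-stable em) R⊆E)) ,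
  (λ _ → mk⇔ (Up⇒Down-⌣ E-sym) (Down⌣⇒Up E-sym)) ,
  (λ _ R-up → Up-graph∘ᴿ isEq α-mono α⊆E R-up
            , Up-∘ᴿgraph isEq (strictly α-surj) α-reflects α⊆E R-up) ,
  (λ _ → Up-graph∘ᴿ∘ᴿgraph isEq β-anti (strictly β-surj) β-reflects β⊆E)
  where
  open UpDownSets _≤_ E
  E-sym : Symmetric E
  E-sym = IsEquivalence.sym isEq
  strictly : {f : X → X} → Surjective _≡_ _≡_ f → StrictlySurjective _≡_ f
  strictly = surjective⇒strictlySurjective _≡_ refl
  α-mono : α Preserves _≤_ ⟶ _≤_
  α-mono = Equivalence.to (α-iso _ _)
  α-reflects : ∀ {x y} → α x ≤ α y → x ≤ y
  α-reflects = Equivalence.from (α-iso _ _)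
  β-anti : β Preserves _≤_ ⟶ flip _≤_
  β-anti = Equivalence.to (β-iso _ _)
  β-reflects : ∀ {x y} → β y ≤ β x → x ≤ y
  β-reflects = Equivalence.from (β-iso _ _)
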